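{- Let $k\ge 2$ and let $c:\mathbb{N}\to\{R,G,B\}$ be rainbow-free for $x-y=z^k$ with dominant color $R$. If $j_1,j_2\in\mathbb{N}$ satisfy $c(j_1)=c(j_2)\neq R$ and $\gcd(j_1,j_2)=1$, then at most one of $j_1,j_2$ has the $A$-property.
   Context: Here $\mathbb{N}=\{1,2,\dots\}$. A rainbow solution to $x-y=z^k$ is an ordered triple $(a_1,a_2,a_3)$ of positive integers with $a_1-a_2=a_3^k$ and $c(a_1),c(a_2),c(a_3)$ pairwise distinct; rainbow-free means none exists. A string of length $\ell$ at position $i$ is $\{i,\dots,i+\ell-1\}$, bichromatic if it contains exactly two colors; a color is dominant if every bichromatic string contains it. An infinite arithmetic progression with initial term $i$ and common difference $d$ is monochromatic if $c(i)=c(i+d)=c(i+2d)=\cdots$. With $R$ dominant, an element $j\in\mathbb{N}$ has the $A$-property if $c(j)\in\{B,G\}$ and there is a monochromatic infinite arithmetic progression with common difference $j^k$ all of whose terms have the other color in $\{B,G\}\setminus\{c(j)\}$. -}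

module Defs where

open import Data.Nat using (ℕ; zero; suc; _+_; _*_; _^_; _≤_; _<_)
open import Data.Product using (Σ; ∃; _×_; _,_)
open import Data.Sum using (_⊎_)
open import Relation.Nullary using (¬_)
open import Relation.Binary.PropositionalEquality using (_≡_; _≢_)

data Color : Set where
  R G B : Color

-- A coloring of ℕ = {1,2,...}; we use functions ℕ → Color and only ever
-- inspect values at positive arguments (the value at 0 is irrelevant).
Coloring : Set
Coloring = ℕ → Color

-- Rainbow solution to x - y = z^k: positive a₁ a₂ a₃ with a₁ - a₂ = a₃^k
-- (stated as a₁ = a₂ + a₃^k) and pairwise distinct colors.
RainbowSolution : ℕ → Coloring → ℕ → ℕ → ℕ → Set
RainbowSolution k c a₁ a₂ a₃ =
  1 ≤ a₁ × 1 ≤ a₂ × 1 ≤ a₃ × a₁ ≡ a₂ + a₃ ^ k ×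
  c a₁ ≢ c a₂ × c a₁ ≢ c a₃ × c a₂ ≢ c a₃

RainbowFree : ℕ → Coloring → Set
RainbowFree k c = ∀ a₁ a₂ a₃ → ¬ RainbowSolution k c a₁ a₂ a₃

Occurs : Coloring → ℕ → ℕ → Color → Set
Occurs c i ℓ x = Σ ℕ λ t → t < ℓ × c (i + t) ≡ x

Bichromatic : Coloring → ℕ → ℕ → Set
Bichromatic c i ℓ =
  Σ Color λ x → Σ Color λ y → x ≢ y × Occurs c i ℓ x × Occurs c i ℓ y ×
    (∀ z → Occurs c i ℓ z → z ≡ x ⊎ z ≡ y)

Dominant : Coloring → Color → Set
Dominant c x = ∀ i ℓ → 1 ≤ i → Bichromatic c i ℓ → Occurs c i ℓ x

MonoAPColored : Coloring → ℕ → ℕ → Color → Set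
MonoAPColored c i d x = 1 ≤ i × (∀ t → c (i + t * d) ≡ x)

other : Color → Color
other B = G
other G = B
other R = R

-- A-property (with R dominant): c j ∈ {B,G} and some monochromatic infinite
-- AP with common difference j^k has all terms of the other color of {B,G}.
AProperty : ℕ → Coloring → ℕ → Set
AProperty k c j =
  (c j ≡ B ⊎ c j ≡ G) × Σ ℕ λ i → MonoAPColored c i (j ^ k) (other (c j))

{-# OPTIONS --safe #-}
-- Let X = c j₁ = c j₂ and let Y be the other color of {B,G}, carried by progressions a + t j₁^k
-- and b + u j₂^k. Shifting the first progression by one keeps it monochromatic (consecutive
-- terms differ by j₁^k and c j₁ = X), never X (by dominance of R, next to Y), and never R
-- (by coprimality it meets the second progression); so every n ≥ a has color Y. Descending from
-- there, n ≥ j₁ cannot be X (next to Y) nor R ((j₁ + n^k, j₁, n) would be rainbow), so c j₁ = Y,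
-- contradicting c j₁ = X.
module Submission where

open import Defs
open import Data.Nat using (ℕ; zero; suc; >-nonZero; _+_; _*_; _∸_; _^_; _≤_; s≤s; z≤n)
open import Data.Nat.Properties
open import Data.Nat.GCD using (gcd; module Bézout)
open import Data.Nat.Coprimality using (Coprime; coprime-Bézout; coprime-divisor; gcd≡1⇒coprime)
import Data.Nat.Coprimality as Coprime
open import Data.Nat.Divisibility using (∣-trans; ∣1⇒≡1)
open import Data.Nat.Solver using (module +-*-Solver)
open import Data.Product using (_×_; _,_; ∃₂)
open import Data.Sum using (_⊎_; inj₁; inj₂)
open import Data.Empty using (⊥-elim)
open import Relation.Nullary using (¬_; yes; no)
open import Relation.Binary.Definitions using (DecidableEquality)
open import Relation.Binary.PropositionalEquality
open +-*-Solver using (solve; _:+_; _:*_; _:=_; con)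

m≤m^n : ∀ m {n} → 1 ≤ n → m ≤ m ^ n
m≤m^n zero          _   = z≤n
m≤m^n m@(suc _) {n} 1≤n = subst (_≤ m ^ n) (*-identityʳ m) (^-monoʳ-≤ m {1} {n} 1≤n)

coprime-*ʳ : ∀ {m n o} → Coprime m n → Coprime m o → Coprime m (n * o)
coprime-*ʳ m⊥n m⊥o (i∣m , i∣no) =
  m⊥o (i∣m , coprime-divisor (λ (j∣i , j∣n) → m⊥n (∣-trans j∣i i∣m , j∣n)) i∣no)

coprime-^ʳ : ∀ {m n} k → Coprime m n → Coprime m (n ^ k)
coprime-^ʳ zero    _   (_ , i∣1) = ∣1⇒≡1 i∣1
coprime-^ʳ (suc k) m⊥n = coprime-*ʳ m⊥n (coprime-^ʳ k m⊥n)

coprime-^ : ∀ {m n} k → Coprime m n → Coprime (m ^ k) (n ^ k)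
coprime-^ k m⊥n = Coprime.sym (coprime-^ʳ k (Coprime.sym (coprime-^ʳ k m⊥n)))

-- With m := e + b p ∸ b we get b + m ≡ e (mod p), and Bézout turns m x q into m + m y p.
progressions-meet-by-Bézout : ∀ {p q x y} → 1 ≤ p → 1 + y * p ≡ x * q →
  ∀ e b → ∃₂ λ t u → e + t * p ≡ b + u * q
progressions-meet-by-Bézout {p} {q} {x} {y} 1≤p bézout e b = b + m * y , m * x , sym meet
  where
  open ≡-Reasoning
  m = e + b * p ∸ b
  b+m≡e+bp : b + m ≡ e + b * p
  b+m≡e+bp = m+[n∸m]≡n (≤-trans (m≤m*n b p {{>-nonZero 1≤p}}) (m≤n+m (b * p) e))
  meet : b + m * x * q ≡ e + (b + m * y) * p
  meet = begin
    b + m * x * q            ≡⟨ cong (b +_) (*-assoc m x q) ⟩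
    b + m * (x * q)          ≡⟨ cong (λ z → b + m * z) (sym bézout) ⟩
    b + m * (1 + y * p)      ≡⟨ solve 4 (λ b m y p → b :+ m :* (con 1 :+ y :* p) := (b :+ m) :+ m :* y :* p) refl b m y p ⟩
    (b + m) + m * y * p      ≡⟨ cong (_+ m * y * p) b+m≡e+bp ⟩
    (e + b * p) + m * y * p  ≡⟨ solve 5 (λ e b m y p → (e :+ b :* p) :+ m :* y :* p := e :+ (b :+ m :* y) :* p) refl e b m y p ⟩
    e + (b + m * y) * p      ∎

progressions-meet : ∀ {p q} → 1 ≤ p → 1 ≤ q → Coprime p q →
  ∀ e b → ∃₂ λ t u → e + t * p ≡ b + u * q
progressions-meet {p} {q} 1≤p 1≤q p⊥q e b with coprime-Bézout p⊥q
... | Bézout.-+ x y eq = progressions-meet-by-Bézout {p} {q} {y} {x} 1≤p eq e b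
... | Bézout.+- x y eq =
  let t , u , meet = progressions-meet-by-Bézout {q} {p} {x} {y} 1≤q eq b e in u , t , sym meet

_≟ᶜ_ : DecidableEquality Color
R ≟ᶜ R = yes refl
G ≟ᶜ G = yes refl
B ≟ᶜ B = yes refl
R ≟ᶜ G = no λ ()
R ≟ᶜ B = no λ ()
G ≟ᶜ R = no λ ()
G ≟ᶜ B = no λ ()
B ≟ᶜ R = no λ ()
B ≟ᶜ G = no λ ()

color-cases : ∀ {X Y} → X ≢ R → Y ≢ R → X ≢ Y → ∀ z → z ≡ R ⊎ z ≡ X ⊎ z ≡ Y
color-cases {R} X≢R _ _ _ = ⊥-elim (X≢R refl)
color-cases {_} {R} _ Y≢R _ _ = ⊥-elim (Y≢R refl)
color-cases {G} {G} _ _ X≢Y _ = ⊥-elim (X≢Y refl)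
color-cases {B} {B} _ _ X≢Y _ = ⊥-elim (X≢Y refl)
color-cases {G} {B} _ _ _ R = inj₁ refl
color-cases {G} {B} _ _ _ G = inj₂ (inj₁ refl)
color-cases {G} {B} _ _ _ B = inj₂ (inj₂ refl)
color-cases {B} {G} _ _ _ R = inj₁ refl
color-cases {B} {G} _ _ _ B = inj₂ (inj₁ refl)
color-cases {B} {G} _ _ _ G = inj₂ (inj₂ refl)

other-≢R : ∀ {x} → x ≡ B ⊎ x ≡ G → other x ≢ R
other-≢R (inj₁ refl) ()
other-≢R (inj₂ refl) ()

≢other : ∀ {x} → x ≡ B ⊎ x ≡ G → x ≢ other x
≢other (inj₁ refl) ()
≢other (inj₂ refl) ()

module ColoringFacts (c : Coloring) where

  occurs-pair : ∀ {i x} → Occurs c i 2 x → x ≡ c i ⊎ x ≡ c (suc i)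
  occurs-pair {i} (0 , _ , cx) = inj₁ (trans (sym cx) (cong c (+-identityʳ i)))
  occurs-pair {i} (1 , _ , cx) = inj₂ (trans (sym cx) (cong c (+-comm i 1)))
  occurs-pair (suc (suc _) , s≤s (s≤s ()) , _)

  bichromatic-pair : ∀ {i} → c i ≢ c (suc i) → Bichromatic c i 2
  bichromatic-pair {i} ci≢ci+1 =
    c i , c (suc i) , ci≢ci+1 ,
    (0 , s≤s z≤n , cong c (+-identityʳ i)) ,
    (1 , s≤s (s≤s z≤n) , cong c (+-comm i 1)) ,
    λ _ → occurs-pair

  dominant-adjacent : Dominant c R → ∀ {i} → 1 ≤ i → c i ≢ R → c (suc i) ≢ R → c i ≡ c (suc i)
  dominant-adjacent dominant {i} 1≤i ci≢R ci+1≢R with c i ≟ᶜ c (suc i)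
  ... | yes ci≡ci+1 = ci≡ci+1
  ... | no ci≢ci+1 with occurs-pair (dominant i 2 1≤i (bichromatic-pair ci≢ci+1))
  ...   | inj₁ R≡ci   = ⊥-elim (ci≢R (sym R≡ci))
  ...   | inj₂ R≡ci+1 = ⊥-elim (ci+1≢R (sym R≡ci+1))

  rainbow-free-≡ : ∀ {k} → RainbowFree k c → ∀ {x y z} → 1 ≤ y → 1 ≤ z → x ≡ y + z ^ k →
    c x ≢ c z → c y ≢ c z → c x ≡ c y
  rainbow-free-≡ rainbow-free {x} {y} {z} 1≤y 1≤z x≡y+z^k cx≢cz cy≢cz with c x ≟ᶜ c y
  ... | yes cx≡cy = cx≡cy
  ... | no cx≢cy = ⊥-elim (rainbow-free x y z
    (subst (1 ≤_) (sym x≡y+z^k) (≤-trans 1≤y (m≤m+n y _)) , 1≤y , 1≤z , x≡y+z^k , cx≢cy , cx≢cz , cy≢cz))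

module Propagation
  {k : ℕ} {c : Coloring} (rainbow-free : RainbowFree k c) (dominant : Dominant c R)
  {X Y : Color} (X≢R : X ≢ R) (Y≢R : Y ≢ R) (X≢Y : X ≢ Y)
  {j : ℕ} (1≤j : 1 ≤ j) (cj≡X : c j ≡ X) where

  open ColoringFacts c

  1≤j^k : 1 ≤ j ^ k
  1≤j^k = m^n>0 j {{>-nonZero 1≤j}} k

  next-to-Y-≢X : ∀ {i} → 1 ≤ i → c i ≡ Y → c (suc i) ≢ X
  next-to-Y-≢X {i} 1≤i ci≡Y ci+1≡X =
    X≢Y (trans (sym ci+1≡X) (trans (sym ci≡ci+1) ci≡Y))
    where
    ci≡ci+1 : c i ≡ c (suc i)
    ci≡ci+1 = dominant-adjacent dominant 1≤i (subst (_≢ R) (sym ci≡Y) Y≢R) (subst (_≢ R) (sym ci+1≡X) X≢R)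

  module _ {i : ℕ} (1≤i : 1 ≤ i) (onY : ∀ t → c (i + t * j ^ k) ≡ Y) where

    shifted-progression-≢X : ∀ t → c (suc i + t * j ^ k) ≢ X
    shifted-progression-≢X t = next-to-Y-≢X (≤-trans 1≤i (m≤m+n i _)) (onY t)

    shifted-progression-constant : ∀ t → c (suc i + t * j ^ k) ≡ c (suc i + 0)
    shifted-progression-constant zero    = refl
    shifted-progression-constant (suc t) =
      trans (rainbow-free-≡ {k} rainbow-free (s≤s z≤n) 1≤j next≡prev+j^k (≢cj (suc t)) (≢cj t))
            (shifted-progression-constant t)
      where
      ≢cj : ∀ t → c (suc i + t * j ^ k) ≢ c j
      ≢cj t = subst (c (suc i + t * j ^ k) ≢_) (sym cj≡X) (shifted-progression-≢X t)
      next≡prev+j^k : suc i + (j ^ k + t * j ^ k) ≡ (suc i + t * j ^ k) + j ^ k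
      next≡prev+j^k = trans (cong (suc i +_) (+-comm (j ^ k) _)) (sym (+-assoc (suc i) _ _))

    shifted-progression-Y : ∀ {q b} → 1 ≤ q → Coprime (j ^ k) q → (∀ u → c (b + u * q) ≡ Y) →
      ∀ t → c (suc i + t * j ^ k) ≡ Y
    shifted-progression-Y {q} {b} 1≤q j^k⊥q onY′ t = trans (shifted-progression-constant t) start≡Y
      where
      start≡Y : c (suc i + 0) ≡ Y
      start≡Y with color-cases X≢R Y≢R X≢Y (c (suc i + 0))
      ... | inj₂ (inj₂ ≡Y) = ≡Y
      ... | inj₂ (inj₁ ≡X) = ⊥-elim (shifted-progression-≢X 0 ≡X)
      ... | inj₁ ≡R with progressions-meet 1≤j^k 1≤q j^k⊥q (suc i) b
      ...   | t′ , u , meet =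
        ⊥-elim (Y≢R (trans (sym (onY′ u)) (trans (cong c (sym meet)) (trans (shifted-progression-constant t′) ≡R))))

  eventually-Y : ∀ {q b} → 1 ≤ q → Coprime (j ^ k) q → (∀ u → c (b + u * q) ≡ Y) →
    ∀ {a} → MonoAPColored c a (j ^ k) Y → ∀ n → a ≤ n → c n ≡ Y
  eventually-Y 1≤q j^k⊥q onY′ {a} (1≤a , onY) n a≤n =
    subst (λ m → c m ≡ Y) (trans (+-identityʳ _) (m∸n+n≡m a≤n)) (translate-onY (n ∸ a) 0)
    where
    translate-onY : ∀ s t → c (s + a + t * j ^ k) ≡ Y
    translate-onY zero    = onY
    translate-onY (suc s) =
      shifted-progression-Y (≤-trans 1≤a (m≤n+m a s)) (translate-onY s) 1≤q j^k⊥q onY′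

  Y-descends-one : 1 ≤ k → ∀ {n} → j ≤ n → c (suc n) ≡ Y → c (j + n ^ k) ≡ Y → c n ≡ Y
  Y-descends-one 1≤k {n} j≤n cn+1≡Y cj+n^k≡Y with color-cases X≢R Y≢R X≢Y (c n)
  ... | inj₂ (inj₂ cn≡Y) = cn≡Y
  ... | inj₂ (inj₁ cn≡X) =
    ⊥-elim (X≢Y (trans (sym cn≡X) (trans cn≡cn+1 cn+1≡Y)))
    where
    cn≡cn+1 : c n ≡ c (suc n)
    cn≡cn+1 = dominant-adjacent dominant (≤-trans 1≤j j≤n)
      (subst (_≢ R) (sym cn≡X) X≢R) (subst (_≢ R) (sym cn+1≡Y) Y≢R)
  ... | inj₁ cn≡R =
    ⊥-elim (X≢Y (trans (sym cj≡X) (trans (sym cj+n^k≡cj) cj+n^k≡Y)))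
    where
    cj+n^k≡cj : c (j + n ^ k) ≡ c j
    cj+n^k≡cj = rainbow-free-≡ {k} rainbow-free 1≤j (≤-trans 1≤j j≤n) refl
      (subst (_≢ c n) (sym cj+n^k≡Y) (subst (Y ≢_) (sym cn≡R) Y≢R))
      (subst (_≢ c n) (sym cj≡X) (subst (X ≢_) (sym cn≡R) X≢R))

  Y-above : ℕ → Set
  Y-above n = ∀ m → n ≤ m → c m ≡ Y

  Y-above-step : 1 ≤ k → ∀ {n} → j ≤ n → Y-above (suc n) → Y-above n
  Y-above-step 1≤k {n} j≤n above m n≤m with m≤n⇒m<n∨m≡n n≤m
  ... | inj₁ n<m  = above m n<m
  ... | inj₂ refl =
    Y-descends-one 1≤k j≤n (above (suc n) ≤-refl) (above (j + n ^ k) (+-mono-≤ 1≤j (m≤m^n n 1≤k)))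

  Y-above-descends : 1 ≤ k → ∀ d {n} → j ≤ n → Y-above (n + d) → Y-above n
  Y-above-descends 1≤k zero    {n} j≤n above = subst Y-above (+-identityʳ n) above
  Y-above-descends 1≤k (suc d) {n} j≤n above =
    Y-above-step 1≤k j≤n (Y-above-descends 1≤k d (≤-trans j≤n (n≤1+n n)) (subst Y-above (+-suc n d) above))

  no-Y-progression : 1 ≤ k → ∀ {q b} → 1 ≤ q → Coprime (j ^ k) q → (∀ u → c (b + u * q) ≡ Y) →
    ∀ {a} → ¬ MonoAPColored c a (j ^ k) Y
  no-Y-progression 1≤k 1≤q j^k⊥q onY′ {a} ap =
    X≢Y (trans (sym cj≡X) (Y-above-descends 1≤k a ≤-refl Y-above-j+a j ≤-refl))
    where
    Y-above-j+a : Y-above (j + a)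
    Y-above-j+a m j+a≤m = eventually-Y 1≤q j^k⊥q onY′ ap m (≤-trans (m≤n+m a j) j+a≤m)

mainTheorem12 : (k : ℕ) → 2 ≤ k → (c : Coloring) → RainbowFree k c → Dominant c R →
    (j₁ j₂ : ℕ) → 1 ≤ j₁ → 1 ≤ j₂ → c j₁ ≡ c j₂ → c j₁ ≢ R → gcd j₁ j₂ ≡ 1 →
    ¬ (AProperty k c j₁ × AProperty k c j₂)
mainTheorem12 k 2≤k c rainbow-free dominant j₁ j₂ 1≤j₁ 1≤j₂ cj₁≡cj₂ cj₁≢R gcd≡1
  ((j₁-BG , a , ap₁) , (_ , b , _ , onY₂)) =
  no-Y-progression (≤-trans (s≤s z≤n) 2≤k) (m^n>0 j₂ {{>-nonZero 1≤j₂}} k)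
    (coprime-^ k (gcd≡1⇒coprime gcd≡1)) (λ u → trans (onY₂ u) (cong other (sym cj₁≡cj₂))) ap₁
  where
  open Propagation {k} rainbow-free dominant cj₁≢R (other-≢R j₁-BG) (≢other j₁-BG) 1≤j₁ refl
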